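{- Let $A$ be a finite set and $w:A^k\to(\mathbb{N}_0,+)$ a weight map. Let $m\in\mathbb{N}$ be the maximum of $w(A^k)$ and let $\rho=\{a\in A^k\mid w(a)=m\}$. Then $\mathrm{Pol}(w)\subseteq\mathrm{PPol}(\rho)$.
   Context: $B_n(A)=\mathrm{Sym}(A^n)$, $B(A)=\bigcup_n B_n(A)$. For a weight map $w:A^k\to(\mathbb{N}_0,+)$, $f\in B_n(A)$ respects $w$ if for every $k\times n$ array $a$ over $A$, the sum of $w$ over the columns of $a$ equals the sum of $w$ over the columns of $f(a)$, the array obtained by applying $f$ to each row of $a$; $\mathrm{Pol}(w)$ is the set of all $f\in B(A)$ respecting $w$. For a relation $\rho\subseteq A^k$, $\mathrm{PPol}(\rho)$ is the set of $f\in B_n(A)$ ($n\in\mathbb{N}$) such that for every $k\times n$ array with all columns in $\rho$, applying $f$ to each row yields an array with all columns in $\rho$. -}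

module Defs where

open import Data.Nat using (ℕ; _≤_)
open import Data.Fin using (Fin)
open import Data.Vec using (Vec; map; transpose)
open import Data.Vec.Relation.Unary.All using (All)
open import Data.Product using (_×_; ∃)
open import Function.Bundles using (_↔_; Inverse)
open import Relation.Binary.PropositionalEquality using (_≡_)
open import Level using (0ℓ)
open import Relation.Unary using (Pred)

Finite : Set → Set
Finite A = ∃ λ s → Fin s ↔ A

B : Set → ℕ → Set
B A n = Vec A n ↔ Vec A n

Array : Set → ℕ → ℕ → Set
Array A k n = Vec (Vec A n) k

applyRows : ∀ {A k n} → B A n → Array A k n → Array A k n
applyRows f a = map (Inverse.to f) a

colWeight : ∀ {A k n} → (Vec A k → ℕ) → Array A k n → ℕ
colWeight w a = Data.Vec.sum (map w (transpose a))

RespectsWeight : ∀ {A k} → (Vec A k → ℕ) → ∀ {n} → B A n → Set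
RespectsWeight {A} {k} w {n} f =
  (a : Array A k n) → colWeight w a ≡ colWeight w (applyRows f a)

PartialPolymorphism : ∀ {A k} → Pred (Vec A k) 0ℓ → ∀ {n} → B A n → Set
PartialPolymorphism {A} {k} ρ {n} f =
  (a : Array A k n) → All ρ (transpose a) → All ρ (transpose (applyRows f a))

IsMaximum : ∀ {A k} → (Vec A k → ℕ) → ℕ → Set
IsMaximum {A} {k} w m = (∃ λ (a : Vec A k) → w a ≡ m) × ((a : Vec A k) → w a ≤ m)

maxRel : ∀ {A : Set} {k} → (Vec A k → ℕ) → ℕ → Pred (Vec A k) 0ℓ
maxRel {A} {k} w m a = w a ≡ m

{-# OPTIONS --safe #-}
module Submission where

open import Defs
open import Data.Nat using (ℕ; _+_; _*_; _≤_)
open import Data.Nat.Properties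
  using (≤-refl; ≤-trans; ≤-reflexive; ≤-antisym; +-mono-≤; +-monoʳ-≤; +-cancelʳ-≤; +-cancelˡ-≡)
open import Data.Vec using (Vec; sum)
open import Data.Vec.Relation.Unary.All using (All; []; _∷_; universal)
open import Data.Vec.Relation.Unary.All.Properties using (map⁺; map⁻)
open import Data.Product using (_×_; _,_)
open import Relation.Binary.PropositionalEquality using (_≡_; refl; sym; cong; cong₂; trans)

-- f preserves the total column weight, and n columns of weight m reach the
-- maximal total n * m; since no column weighs more than m, a total of n * m
-- forces every column of the image to weigh exactly m.

+-≤-tight : ∀ {x y m z} → x ≤ m → y ≤ z → x + y ≡ m + z → x ≡ m × y ≡ z
+-≤-tight {x} {y} {m} {z} x≤m y≤z eq = x≡m , +-cancelˡ-≡ m y z (trans (cong (_+ y) (sym x≡m)) eq)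
  where
  x≡m : x ≡ m
  x≡m = ≤-antisym x≤m (+-cancelʳ-≤ z m x (≤-trans (≤-reflexive (sym eq)) (+-monoʳ-≤ x y≤z)))

module _ {m : ℕ} where

  All≡⇒sum≡* : ∀ {n} {xs : Vec ℕ n} → All (_≡ m) xs → sum xs ≡ n * m
  All≡⇒sum≡* []         = refl
  All≡⇒sum≡* (px ∷ pxs) = cong₂ _+_ px (All≡⇒sum≡* pxs)

  All≤⇒sum≤* : ∀ {n} {xs : Vec ℕ n} → All (_≤ m) xs → sum xs ≤ n * m
  All≤⇒sum≤* []         = ≤-refl
  All≤⇒sum≤* (px ∷ pxs) = +-mono-≤ px (All≤⇒sum≤* pxs)

  All≤∧sum≡*⇒All≡ : ∀ {n} {xs : Vec ℕ n} → All (_≤ m) xs → sum xs ≡ n * m → All (_≡ m) xs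
  All≤∧sum≡*⇒All≡ []         _   = []
  All≤∧sum≡*⇒All≡ (px ∷ pxs) eq =
    let x≡m , sum≡ = +-≤-tight px (All≤⇒sum≤* pxs) eq
    in x≡m ∷ All≤∧sum≡*⇒All≡ pxs sum≡

lemma14 : (A : Set) → Finite A → (k : ℕ) → (w : Vec A k → ℕ) → (m : ℕ) →
    IsMaximum w m →
    (n : ℕ) → (f : B A n) → RespectsWeight w f →
    PartialPolymorphism (maxRel w m) f
lemma14 A _ k w m (_ , w≤m) n f respects a columnsMaximal =
  map⁻ (All≤∧sum≡*⇒All≡ (map⁺ (universal w≤m _)) weight-of-image)
  where
  weight-of-image : colWeight w (applyRows f a) ≡ n * m
  weight-of-image = trans (sym (respects a)) (All≡⇒sum≡* (map⁺ columnsMaximal))
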